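{- Let $n$ and $m$ be integers such that $n+2$ is divisible by $4$ and $n \le m \le \frac{1}{16}n^2 + \frac{5}{4}n - \frac{7}{4}$. Then there exists a strongly connected simple bipartite graph $G=(V,E)$ with $|V|=n$ vertices and $|E|=m$ edges that has exactly $|E|-|V|+2$ perfect matchings.
   Context: For a bipartite graph $G$ with colour classes $V_1,V_2$ and a perfect matching $M$, let $D(G,M)$ be the directed graph on $V(G)$ in which every edge of $M$ is oriented from $V_1$ to $V_2$ and every edge of $E\setminus M$ is oriented from $V_2$ to $V_1$. A bipartite graph $G$ with at least one perfect matching is called strongly connected if $D(G,M)$ is strongly connected for a perfect matching $M$ of $G$ (this does not depend on the choice of $M$). -}

module Defs where

open import Data.Bool using (Bool; true; false; _∧_; _∨_; not; T)
open import Data.Nat using (ℕ; zero; suc; _+_; _≡ᵇ_)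
open import Data.List as List using (List; []; _∷_; concatMap; length; filterᵇ)
open import Data.Vec as Vec using (Vec; []; _∷_; lookup; transpose; countᵇ; sum; zipWith; toList)
open import Data.Fin using (Fin)
open import Data.Sum using (_⊎_; inj₁; inj₂)
open import Data.Empty using (⊥)
open import Relation.Binary.Construct.Closure.ReflexiveTransitive using (Star)

Matrix : ℕ → ℕ → Set
Matrix a b = Vec (Vec Bool b) a

entry : ∀ {a b} → Matrix a b → Fin a → Fin b → Bool
entry M i j = lookup (lookup M i) j

-- A simple bipartite graph with colour classes V₁ = Fin left and V₂ = Fin right;
-- adj i j = true  iff  {i , j} is an edge.
record BipartiteGraph : Set where
  constructor bipartite
  field
    left  : ℕ
    right : ℕ
    adj   : Matrix left right

open BipartiteGraph public

Vertex : BipartiteGraph → Set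
Vertex G = Fin (left G) ⊎ Fin (right G)

numVertices : BipartiteGraph → ℕ
numVertices G = left G + right G

numTrue : ∀ {k} → Vec Bool k → ℕ
numTrue = countᵇ (λ x → x)

numEdges : BipartiteGraph → ℕ
numEdges G = sum (Vec.map numTrue (adj G))

allTrue : List Bool → Bool
allTrue = List.foldr _∧_ true

-- M (an edge subset, as a matrix) is a perfect matching of G:
-- M ⊆ E, every vertex of V₁ lies in exactly one edge of M, and
-- every vertex of V₂ lies in exactly one edge of M.
isPerfectMatchingᵇ : (G : BipartiteGraph) → Matrix (left G) (right G) → Bool
isPerfectMatchingᵇ G M =
  allTrue (toList (zipWith (λ e r → allTrue (toList (zipWith (λ x y → not y ∨ x) e r))) (adj G) M))
  ∧ allTrue (toList (Vec.map (λ r → numTrue r ≡ᵇ 1) M))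
  ∧ allTrue (toList (Vec.map (λ c → numTrue c ≡ᵇ 1) (transpose M)))

IsPerfectMatching : (G : BipartiteGraph) → Matrix (left G) (right G) → Set
IsPerfectMatching G M = T (isPerfectMatchingᵇ G M)

allVecs : ∀ {A : Set} → List A → (k : ℕ) → List (Vec A k)
allVecs xs zero    = [] ∷ []
allVecs xs (suc k) = concatMap (λ x → List.map (x ∷_) (allVecs xs k)) xs

allMatrices : (a b : ℕ) → List (Matrix a b)
allMatrices a b = allVecs (allVecs (true ∷ false ∷ []) b) a

numPerfectMatchings : BipartiteGraph → ℕ
numPerfectMatchings G = length (filterᵇ (isPerfectMatchingᵇ G) (allMatrices (left G) (right G)))

-- The digraph D(G, M): M-edges oriented V₁ → V₂, other edges V₂ → V₁.
Arc : (G : BipartiteGraph) → Matrix (left G) (right G) → Vertex G → Vertex G → Set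
Arc G M (inj₁ i) (inj₂ j) = T (entry M i j)
Arc G M (inj₂ j) (inj₁ i) = T (entry (adj G) i j ∧ not (entry M i j))
Arc G M (inj₁ _) (inj₁ _) = ⊥
Arc G M (inj₂ _) (inj₂ _) = ⊥

DStronglyConnected : (G : BipartiteGraph) → Matrix (left G) (right G) → Set
DStronglyConnected G M = ∀ u v → Star (Arc G M) u v

data StronglyConnected (G : BipartiteGraph) : Set where
  strong : (M : Matrix (left G) (right G)) → IsPerfectMatching G M →
           DStronglyConnected G M → StronglyConnected G

{-# OPTIONS --safe #-}
module Submission where

open import Defs
open import Data.Nat using (ℕ; _+_; _*_; _∸_; _≤_)
open import Data.Nat.Divisibility using (_∣_)
open import Data.Product using (_×_; ∃-syntax)
open import Relation.Binary.PropositionalEquality using (_≡_)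

open import Algebra.Bundles using (CommutativeMonoid)
open import Data.Bool using (Bool; true; false; _∧_; _∨_; not; T; if_then_else_)
open import Data.Bool.Properties
  using (∧-commutativeMonoid; ∧-identityʳ; ∧-zeroʳ; ∨-zeroʳ; ∨-identityʳ; ∨-comm)
open import Data.Fin using (Fin; toℕ; fromℕ<) renaming (zero to fzero; suc to fsuc)
open import Data.Fin.Properties using (toℕ<n; toℕ-fromℕ<; toℕ-injective)
open import Data.List as List using (List; []; _∷_; _++_; concatMap; length; filterᵇ)
open import Data.List.Properties using (map-++; map-∘; map-cong; ++-identityʳ)
open import Data.Nat using (zero; suc; _<_; _≡ᵇ_; _<ᵇ_; _⊓_; z≤n; s≤s)
open import Data.Nat.Divisibility using (divides)
open import Data.Nat.ListAction using (sum)
open import Data.Nat.ListAction.Properties using (sum-++)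
open import Data.Nat.Properties
open import Data.Nat.Tactic.RingSolver using (solve-∀)
open import Data.Product using (_,_)
open import Data.Sum using (inj₁; inj₂)
open import Data.Unit using (tt)
open import Data.Vec as Vec using (Vec; []; _∷_; lookup; tabulate; toList; zipWith; replicate; transpose)
open import Data.Vec.Properties using (zipWith-is-⊛; lookup∘tabulate; lookup-zipWith; lookup-replicate)
open import Function using (_∘_)
open import Relation.Binary using (tri<; tri≈; tri>)
open import Relation.Binary.Construct.Closure.ReflexiveTransitive using (Star; ε; _◅◅_)
open import Relation.Binary.Construct.Closure.ReflexiveTransitive.Properties using (module StarReasoning)
open import Relation.Binary.PropositionalEquality
open import Relation.Nullary using (yes; no; contradiction)
open import Algebra.Properties.CommutativeSemigroup +-commutativeSemigroup using (interchange)
open import Algebra.Properties.CommutativeSemigroup (CommutativeMonoid.commutativeSemigroup ∧-commutativeMonoid)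
  using () renaming (interchange to ∧-interchange; x∙yz≈y∙xz to ∧-leftComm)

-- Write n = 4c + 2 and m = (n − 1) + b.  Take colour classes {0, …, 2c}, join left vertex i to the
-- right vertices i and i + 1 (a Hamiltonian path with n − 1 edges), and add b chords, each joining a
-- row i ≥ c to a column j ≤ c with j < i.  For the diagonal matching M, D(G, M) contains the cycle
-- L₂c → R₂c → L₂c₋₁ → ⋯ → L₀ → R₀ → L₂c through all vertices, closed by the chord (2c, 0); so G is
-- strongly connected.  Another perfect matching differs from M by disjoint M-alternating cycles; such a
-- cycle descends along the path and climbs only along chords, and a cycle through a chord (i, j) covers
-- the rows j, …, i.  All these intervals contain c, so the difference is one cycle through one chord,
-- and G has exactly b + 1 = m − n + 2 perfect matchings.  Formally, perfect matchings are counted by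
-- expanding along the rows: once rows 0, …, i − 1 are matched, the free columns are u and all columns
-- above i for some u ≤ i, and the resulting recursion has an explicit solution.

iverson : Bool → ℕ
iverson β = if β then 1 else 0

≡ᵇ-refl : ∀ n → (n ≡ᵇ n) ≡ true
≡ᵇ-refl zero    = refl
≡ᵇ-refl (suc n) = ≡ᵇ-refl n

≢⇒≡ᵇ-false : ∀ {m n} → m ≢ n → (m ≡ᵇ n) ≡ false
≢⇒≡ᵇ-false {zero}  {zero}  m≢n = contradiction refl m≢n
≢⇒≡ᵇ-false {zero}  {suc n} _   = refl
≢⇒≡ᵇ-false {suc m} {zero}  _   = refl
≢⇒≡ᵇ-false {suc m} {suc n} m≢n = ≢⇒≡ᵇ-false (m≢n ∘ cong suc)

<⇒<ᵇ-true : ∀ {m n} → m < n → (m <ᵇ n) ≡ true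
<⇒<ᵇ-true {zero}  {suc n} _         = refl
<⇒<ᵇ-true {suc m} {suc n} (s≤s m<n) = <⇒<ᵇ-true m<n

≥⇒<ᵇ-false : ∀ {m n} → n ≤ m → (m <ᵇ n) ≡ false
≥⇒<ᵇ-false {m}     {zero}  _         = refl
≥⇒<ᵇ-false {suc m} {suc n} (s≤s n≤m) = ≥⇒<ᵇ-false n≤m

∸≡∸-suc+[<] : ∀ m n → m ∸ n ≡ (m ∸ suc n) + iverson (n <ᵇ m)
∸≡∸-suc+[<] zero    zero    = refl
∸≡∸-suc+[<] zero    (suc n) = refl
∸≡∸-suc+[<] (suc m) zero    = +-comm 1 m
∸≡∸-suc+[<] (suc m) (suc n) = ∸≡∸-suc+[<] m n

m⊓[n∸o]+n⊓o≡n⊓[m+o] : ∀ m n o → m ⊓ (n ∸ o) + n ⊓ o ≡ n ⊓ (m + o)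
m⊓[n∸o]+n⊓o≡n⊓[m+o] m n o with o ≤? n
... | yes o≤n rewrite m≥n⇒m⊓n≡n o≤n =
  trans (+-distribʳ-⊓ o m (n ∸ o)) (trans (cong ((m + o) ⊓_) (m∸n+n≡m o≤n)) (⊓-comm (m + o) n))
... | no o≰n rewrite m≤n⇒m∸n≡0 (<⇒≤ (≰⇒> o≰n)) | ⊓-zeroʳ m | m≤n⇒m⊓n≡m (<⇒≤ (≰⇒> o≰n)) =
  sym (m≤n⇒m⊓n≡m (≤-trans (<⇒≤ (≰⇒> o≰n)) (m≤n+m o m)))

variable
  X Y : Set

sumMap-++ : (f : X → ℕ) (xs ys : List X) →
            sum (List.map f (xs ++ ys)) ≡ sum (List.map f xs) + sum (List.map f ys)
sumMap-++ f xs ys = trans (cong sum (map-++ f xs ys)) (sum-++ (List.map f xs) _)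

sumMap-zero : (xs : List X) → sum (List.map (λ _ → 0) xs) ≡ 0
sumMap-zero []       = refl
sumMap-zero (_ ∷ xs) = sumMap-zero xs

count : (X → Bool) → List X → ℕ
count p xs = length (filterᵇ p xs)

count-++ : ∀ p (xs ys : List X) → count p (xs ++ ys) ≡ count p xs + count p ys
count-++ p []       ys = refl
count-++ p (x ∷ xs) ys with p x
... | true  = cong suc (count-++ p xs ys)
... | false = count-++ p xs ys

count-cong : ∀ {p q : X → Bool} → (∀ x → p x ≡ q x) → ∀ xs → count p xs ≡ count q xs
count-cong {p = p} {q} p≗q []       = refl
count-cong {p = p} {q} p≗q (x ∷ xs) with p x | q x | p≗q x
... | true  | .true  | refl = cong suc (count-cong p≗q xs)
... | false | .false | refl = count-cong p≗q xs

count-∧ : ∀ β (q : X → Bool) xs → count (λ x → β ∧ q x) xs ≡ (if β then count q xs else 0)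
count-∧ true  q xs       = refl
count-∧ false q []       = refl
count-∧ false q (_ ∷ xs) = count-∧ false q xs

count-concatMap : ∀ (p : Y → Bool) (f : X → List Y) xs →
                  count p (concatMap f xs) ≡ sum (List.map (count p ∘ f) xs)
count-concatMap p f []       = refl
count-concatMap p f (x ∷ xs) =
  trans (count-++ p (f x) (concatMap f xs)) (cong (count p (f x) +_) (count-concatMap p f xs))

count-map : ∀ (p : Y → Bool) (g : X → Y) xs → count p (List.map g xs) ≡ count (p ∘ g) xs
count-map p g []       = refl
count-map p g (x ∷ xs) with p (g x)
... | true  = cong suc (count-map p g xs)
... | false = count-map p g xs

sumRange : ℕ → ℕ → (ℕ → ℕ) → ℕ
sumRange i zero    f = 0
sumRange i (suc r) f = f i + sumRange (suc i) r f

<-+-suc : ∀ i r → i < i + suc r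
<-+-suc i r = m<m+n i (s≤s z≤n)

sumRange-cong : ∀ i r {f g : ℕ → ℕ} → (∀ j → i ≤ j → j < i + r → f j ≡ g j) →
                sumRange i r f ≡ sumRange i r g
sumRange-cong i zero    f≗g = refl
sumRange-cong i (suc r) f≗g =
  cong₂ _+_ (f≗g i ≤-refl (<-+-suc i r))
            (sumRange-cong (suc i) r λ j i<j j<i+r → f≗g j (<⇒≤ i<j) (subst (j <_) (sym (+-suc i r)) j<i+r))

sumRange-zero : ∀ i r {f : ℕ → ℕ} → (∀ j → i ≤ j → j < i + r → f j ≡ 0) → sumRange i r f ≡ 0
sumRange-zero i zero    f≗0 = refl
sumRange-zero i (suc r) f≗0 =
  cong₂ _+_ (f≗0 i ≤-refl (<-+-suc i r))
            (sumRange-zero (suc i) r λ j i<j j<i+r → f≗0 j (<⇒≤ i<j) (subst (j <_) (sym (+-suc i r)) j<i+r))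

sumRange-single : ∀ i r p {f : ℕ → ℕ} → i ≤ p → p < i + r → (∀ j → j ≢ p → f j ≡ 0) →
                  sumRange i r f ≡ f p
sumRange-single i zero    p i≤p p<i+0 _ = contradiction (subst (p <_) (+-identityʳ i) p<i+0) (≤⇒≯ i≤p)
sumRange-single i (suc r) p {f} i≤p p<i+r f≗0 with m≤n⇒m<n∨m≡n i≤p
... | inj₂ refl =
  trans (cong (f i +_) (sumRange-zero (suc i) r λ j i<j _ → f≗0 j (<⇒≢ i<j ∘ sym))) (+-identityʳ (f i))
... | inj₁ i<p =
  cong₂ _+_ (f≗0 i (<⇒≢ i<p)) (sumRange-single (suc i) r p i<p (subst (p <_) (+-suc i r) p<i+r) f≗0)

sumRange-indicator : ∀ r p v → p < r → sumRange 0 r (λ j → if j ≡ᵇ p then v else 0) ≡ v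
sumRange-indicator r p v p<r =
  trans (sumRange-single 0 r p z≤n p<r off) (cong (λ β → if β then v else 0) (≡ᵇ-refl p))
  where
  off : ∀ j → j ≢ p → (if j ≡ᵇ p then v else 0) ≡ 0
  off j j≢p rewrite ≢⇒≡ᵇ-false j≢p = refl

sumRange-indicator-≥ : ∀ r p v → r ≤ p → sumRange 0 r (λ j → if j ≡ᵇ p then v else 0) ≡ 0
sumRange-indicator-≥ r p v r≤p = sumRange-zero 0 r off
  where
  off : ∀ j → 0 ≤ j → j < r → (if j ≡ᵇ p then v else 0) ≡ 0
  off j _ j<r rewrite ≢⇒≡ᵇ-false (<⇒≢ (<-≤-trans j<r r≤p)) = refl

sumRange-const : ∀ i r v → sumRange i r (λ _ → v) ≡ r * v
sumRange-const i zero    v = refl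
sumRange-const i (suc r) v = cong (v +_) (sumRange-const (suc i) r v)

sumRange-shift : ∀ i r (f : ℕ → ℕ) → sumRange (suc i) r f ≡ sumRange i r (f ∘ suc)
sumRange-shift i zero    f = refl
sumRange-shift i (suc r) f = cong (f (suc i) +_) (sumRange-shift (suc i) r f)

sumRange-+ : ∀ i r (f g : ℕ → ℕ) → sumRange i r (λ j → f j + g j) ≡ sumRange i r f + sumRange i r g
sumRange-+ i zero    f g = refl
sumRange-+ i (suc r) f g =
  trans (cong (f i + g i +_) (sumRange-+ (suc i) r f g)) (interchange (f i) (g i) _ _)

sumRange-++ : ∀ i r s (f : ℕ → ℕ) → sumRange i (r + s) f ≡ sumRange i r f + sumRange (i + r) s f
sumRange-++ i zero    s f = cong (λ i′ → sumRange i′ s f) (sym (+-identityʳ i))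
sumRange-++ i (suc r) s f rewrite sumRange-++ (suc i) r s f | +-suc i r = sym (+-assoc (f i) _ _)

sumRange-below : ∀ b L → L ≤ b → sumRange 0 b (λ j → iverson (j <ᵇ L)) ≡ L
sumRange-below b       zero    _         = sumRange-zero 0 b (λ _ _ _ → refl)
sumRange-below (suc b) (suc L) (s≤s L≤b) =
  cong suc (trans (sumRange-shift 0 b _) (sumRange-below b L L≤b))

_⊆ᵇ_ : ∀ {b} → Vec Bool b → Vec Bool b → Bool
r ⊆ᵇ e = allTrue (toList (zipWith (λ x y → not y ∨ x) e r))

_∖_ : ∀ {b} → Vec Bool b → Vec Bool b → Vec Bool b
d ∖ r = zipWith (λ δ x → δ ∧ not x) d r

hasColumnCountsᵇ : ∀ {a b} → Vec (Vec Bool a) b → Vec Bool b → Bool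
hasColumnCountsᵇ cols d = allTrue (toList (zipWith (λ col δ → numTrue col ≡ᵇ iverson δ) cols d))

isMatchingRowᵇ : ∀ {b} → Vec Bool b → Vec Bool b → Vec Bool b → Bool
isMatchingRowᵇ e d r = r ⊆ᵇ e ∧ ((numTrue r ≡ᵇ 1) ∧ r ⊆ᵇ d)

matchesOntoᵇ : ∀ {a b} → Matrix a b → Vec Bool b → Matrix a b → Bool
matchesOntoᵇ {b = b} []      d []      = hasColumnCountsᵇ (replicate b []) d
matchesOntoᵇ         (e ∷ E) d (r ∷ M) = isMatchingRowᵇ e d r ∧ matchesOntoᵇ E (d ∖ r) M

hasColumnCounts-∷ : ∀ {a b} (r : Vec Bool b) (cols : Vec (Vec Bool a) b) d →
  hasColumnCountsᵇ (zipWith _∷_ r cols) d ≡ r ⊆ᵇ d ∧ hasColumnCountsᵇ cols (d ∖ r)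
hasColumnCounts-∷ []          []           []          = refl
hasColumnCounts-∷ (true ∷ r)  (col ∷ cols) (true ∷ d)  =
  trans (cong ((numTrue col ≡ᵇ 0) ∧_) (hasColumnCounts-∷ r cols d))
        (∧-leftComm (numTrue col ≡ᵇ 0) (r ⊆ᵇ d) (hasColumnCountsᵇ cols (d ∖ r)))
hasColumnCounts-∷ (true ∷ r)  (col ∷ cols) (false ∷ d) = refl
hasColumnCounts-∷ (false ∷ r) (col ∷ cols) (true ∷ d)  =
  trans (cong ((numTrue col ≡ᵇ 1) ∧_) (hasColumnCounts-∷ r cols d))
        (∧-leftComm (numTrue col ≡ᵇ 1) (r ⊆ᵇ d) (hasColumnCountsᵇ cols (d ∖ r)))
hasColumnCounts-∷ (false ∷ r) (col ∷ cols) (false ∷ d) =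
  trans (cong ((numTrue col ≡ᵇ 0) ∧_) (hasColumnCounts-∷ r cols d))
        (∧-leftComm (numTrue col ≡ᵇ 0) (r ⊆ᵇ d) (hasColumnCountsᵇ cols (d ∖ r)))

rowsWithinᵇ : ∀ {a b} → Matrix a b → Matrix a b → Bool
rowsWithinᵇ E M = allTrue (toList (zipWith (λ e r → r ⊆ᵇ e) E M))

rowsUnitᵇ : ∀ {a b} → Matrix a b → Bool
rowsUnitᵇ M = allTrue (toList (Vec.map (λ r → numTrue r ≡ᵇ 1) M))

matchesOnto-byConditions : ∀ {a b} (E M : Matrix a b) d →
  rowsWithinᵇ E M ∧ (rowsUnitᵇ M ∧ hasColumnCountsᵇ (transpose M) d) ≡ matchesOntoᵇ E d M
matchesOnto-byConditions []      []      d = refl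
matchesOnto-byConditions (e ∷ E) (r ∷ M) d = begin
  (r ⊆ᵇ e ∧ within) ∧ (((numTrue r ≡ᵇ 1) ∧ unit) ∧ hasColumnCountsᵇ (transpose (r ∷ M)) d)
    ≡⟨ cong (λ cols → (r ⊆ᵇ e ∧ within) ∧ (((numTrue r ≡ᵇ 1) ∧ unit) ∧ hasColumnCountsᵇ cols d))
            (sym (zipWith-is-⊛ _∷_ r (transpose M))) ⟩
  (r ⊆ᵇ e ∧ within) ∧ (((numTrue r ≡ᵇ 1) ∧ unit) ∧ hasColumnCountsᵇ (zipWith _∷_ r (transpose M)) d)
    ≡⟨ cong (λ x → (r ⊆ᵇ e ∧ within) ∧ (((numTrue r ≡ᵇ 1) ∧ unit) ∧ x))
            (hasColumnCounts-∷ r (transpose M) d) ⟩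
  (r ⊆ᵇ e ∧ within) ∧ (((numTrue r ≡ᵇ 1) ∧ unit) ∧ (r ⊆ᵇ d ∧ columns))
    ≡⟨ cong ((r ⊆ᵇ e ∧ within) ∧_) (∧-interchange (numTrue r ≡ᵇ 1) unit (r ⊆ᵇ d) columns) ⟩
  (r ⊆ᵇ e ∧ within) ∧ (((numTrue r ≡ᵇ 1) ∧ r ⊆ᵇ d) ∧ (unit ∧ columns))
    ≡⟨ ∧-interchange (r ⊆ᵇ e) within ((numTrue r ≡ᵇ 1) ∧ r ⊆ᵇ d) (unit ∧ columns) ⟩
  isMatchingRowᵇ e d r ∧ (within ∧ (unit ∧ columns))
    ≡⟨ cong (isMatchingRowᵇ e d r ∧_) (matchesOnto-byConditions E M (d ∖ r)) ⟩
  isMatchingRowᵇ e d r ∧ matchesOntoᵇ E (d ∖ r) M ∎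
  where
  open ≡-Reasoning
  within = rowsWithinᵇ E M
  unit = rowsUnitᵇ M
  columns = hasColumnCountsᵇ (transpose M) (d ∖ r)

hasColumnCounts-one : ∀ {a b} (cols : Vec (Vec Bool a) b) →
  Vec.map (λ col → numTrue col ≡ᵇ 1) cols ≡
  zipWith (λ col δ → numTrue col ≡ᵇ iverson δ) cols (replicate b true)
hasColumnCounts-one []           = refl
hasColumnCounts-one (col ∷ cols) = cong (_ ∷_) (hasColumnCounts-one cols)

isPerfectMatching-byRows : ∀ {a b} (E M : Matrix a b) →
  isPerfectMatchingᵇ (bipartite a b E) M ≡ matchesOntoᵇ E (replicate b true) M
isPerfectMatching-byRows {b = b} E M =
  trans (cong (λ cs → rowsWithinᵇ E M ∧ (rowsUnitᵇ M ∧ allTrue (toList cs)))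
              (hasColumnCounts-one (transpose M)))
        (matchesOnto-byConditions E M (replicate b true))

bools : List Bool
bools = true ∷ false ∷ []

numMatchingsOnto : ∀ {a b} → Matrix a b → Vec Bool b → ℕ
numMatchingsOnto {a} {b} E d = count (matchesOntoᵇ E d) (allMatrices a b)

numPerfectMatchings-byRows : ∀ {a b} (E : Matrix a b) →
  numPerfectMatchings (bipartite a b E) ≡ numMatchingsOnto E (replicate b true)
numPerfectMatchings-byRows {a} {b} E = count-cong (isPerfectMatching-byRows E) (allMatrices a b)

numMatchingsOnto-[] : ∀ {b} (d : Vec Bool b) → numMatchingsOnto [] d ≡ iverson (matchesOntoᵇ [] d [])
numMatchingsOnto-[] {b} d with hasColumnCountsᵇ (replicate b []) d
... | true  = refl
... | false = refl

numMatchingsOnto-byFirstRow : ∀ {a b} (e : Vec Bool b) (E : Matrix a b) d →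
  numMatchingsOnto (e ∷ E) d ≡
  sum (List.map (λ r → if isMatchingRowᵇ e d r then numMatchingsOnto E (d ∖ r) else 0) (allVecs bools b))
numMatchingsOnto-byFirstRow {a} {b} e E d =
  trans (count-concatMap _ (λ r → List.map (r ∷_) (allMatrices a b)) (allVecs bools b))
        (cong sum (map-cong (λ r → trans (count-map _ (r ∷_) (allMatrices a b))
                                         (count-∧ (isMatchingRowᵇ e d r) (matchesOntoᵇ E (d ∖ r)) (allMatrices a b)))
                            (allVecs bools b)))

-- Row expansion of a permanent: expand e d g = Σ { g (d without j) | j ∈ e ∩ d }.
expand : ∀ {b} → Vec Bool b → Vec Bool b → (Vec Bool b → ℕ) → ℕ
expand []      []      g = 0
expand (x ∷ e) (δ ∷ d) g = (if x ∧ δ then g (false ∷ d) else 0) + expand e d (λ d′ → g (δ ∷ d′))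

empty-⊆ᵇ : ∀ {b} (e : Vec Bool b) → replicate b false ⊆ᵇ e ≡ true
empty-⊆ᵇ []      = refl
empty-⊆ᵇ (_ ∷ e) = empty-⊆ᵇ e

∖-empty : ∀ {b} (d : Vec Bool b) → d ∖ replicate b false ≡ d
∖-empty []      = refl
∖-empty (δ ∷ d) = cong₂ _∷_ (∧-identityʳ δ) (∖-empty d)

numTrue-empty : ∀ b → numTrue (replicate b false) ≡ 0
numTrue-empty zero    = refl
numTrue-empty (suc b) = numTrue-empty b

sum-allVecs-supportedOnEmpty : ∀ {b} (f : Vec Bool b → ℕ) →
  (∀ r → (numTrue r ≡ᵇ 0) ≡ false → f r ≡ 0) →
  sum (List.map f (allVecs bools b)) ≡ f (replicate b false)
sum-allVecs-supportedOnEmpty {zero}  f _   = +-identityʳ (f [])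
sum-allVecs-supportedOnEmpty {suc b} f f≗0 = begin
  sum (List.map f (List.map (true ∷_) rs ++ List.map (false ∷_) rs ++ []))
    ≡⟨ sumMap-++ f (List.map (true ∷_) rs) _ ⟩
  sum (List.map f (List.map (true ∷_) rs)) + sum (List.map f (List.map (false ∷_) rs ++ []))
    ≡⟨ cong₂ _+_ nonEmpty (cong (sum ∘ List.map f) (++-identityʳ (List.map (false ∷_) rs))) ⟩
  sum (List.map f (List.map (false ∷_) rs))
    ≡⟨ cong sum (sym (map-∘ rs)) ⟩
  sum (List.map (f ∘ (false ∷_)) rs)
    ≡⟨ sum-allVecs-supportedOnEmpty (f ∘ (false ∷_)) (λ r → f≗0 (false ∷ r)) ⟩
  f (replicate (suc b) false) ∎
  where
  open ≡-Reasoning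
  rs = allVecs bools b
  nonEmpty : sum (List.map f (List.map (true ∷_) rs)) ≡ 0
  nonEmpty =
    trans (cong sum (trans (sym (map-∘ rs)) (map-cong (λ r → f≗0 (true ∷ r) refl) rs))) (sumMap-zero rs)

sum-matchingRows : ∀ {b} (e d : Vec Bool b) (g : Vec Bool b → ℕ) →
  sum (List.map (λ r → if isMatchingRowᵇ e d r then g (d ∖ r) else 0) (allVecs bools b)) ≡ expand e d g
sum-matchingRows []      []      g = refl
sum-matchingRows {suc b} (x ∷ e) (δ ∷ d) g = begin
  sum (List.map F (List.map (true ∷_) rs ++ List.map (false ∷_) rs ++ []))
    ≡⟨ sumMap-++ F (List.map (true ∷_) rs) _ ⟩
  sum (List.map F (List.map (true ∷_) rs)) + sum (List.map F (List.map (false ∷_) rs ++ []))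
    ≡⟨ cong₂ _+_ (cong sum (sym (map-∘ rs)))
                 (cong sum (trans (cong (List.map F) (++-identityʳ (List.map (false ∷_) rs))) (sym (map-∘ rs)))) ⟩
  sum (List.map (F ∘ (true ∷_)) rs) + sum (List.map (F ∘ (false ∷_)) rs)
    ≡⟨ cong₂ _+_ (sum-allVecs-supportedOnEmpty (F ∘ (true ∷_)) nonEmpty)
                 (sum-matchingRows e d (λ d′ → g ((δ ∧ true) ∷ d′))) ⟩
  F (true ∷ replicate b false) + expand e d (λ d′ → g ((δ ∧ true) ∷ d′))
    ≡⟨ cong₂ _+_ singleton (cong (λ δ′ → expand e d (λ d′ → g (δ′ ∷ d′))) (∧-identityʳ δ)) ⟩
  (if x ∧ δ then g (false ∷ d) else 0) + expand e d (λ d′ → g (δ ∷ d′)) ∎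
  where
  open ≡-Reasoning
  rs = allVecs bools b
  F : Vec Bool (suc b) → ℕ
  F r = if isMatchingRowᵇ (x ∷ e) (δ ∷ d) r then g ((δ ∷ d) ∖ r) else 0
  nonEmpty : ∀ r → (numTrue r ≡ᵇ 0) ≡ false → F (true ∷ r) ≡ 0
  nonEmpty r r≢∅ rewrite r≢∅ | ∧-zeroʳ (x ∧ r ⊆ᵇ e) = refl
  singleton : F (true ∷ replicate b false) ≡ (if x ∧ δ then g (false ∷ d) else 0)
  singleton rewrite empty-⊆ᵇ e | numTrue-empty b | empty-⊆ᵇ d | ∖-empty d
                  | ∧-identityʳ x | ∧-identityʳ δ | ∧-zeroʳ δ = refl

numMatchingsOnto-∷ : ∀ {a b} (e : Vec Bool b) (E : Matrix a b) d →
  numMatchingsOnto (e ∷ E) d ≡ expand e d (numMatchingsOnto E)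
numMatchingsOnto-∷ e E d = trans (numMatchingsOnto-byFirstRow e E d) (sum-matchingRows e d (numMatchingsOnto E))

matchesOnto-[]-allFalse : ∀ {b} (d : Vec Bool b) → (∀ j → lookup d j ≡ false) → matchesOntoᵇ [] d [] ≡ true
matchesOnto-[]-allFalse []      _      = refl
matchesOnto-[]-allFalse (δ ∷ d) d≗false rewrite d≗false fzero = matchesOnto-[]-allFalse d (d≗false ∘ fsuc)

matchesOnto-[]-someTrue : ∀ {b} (d : Vec Bool b) j → lookup d j ≡ true → matchesOntoᵇ [] d [] ≡ false
matchesOnto-[]-someTrue (δ     ∷ d) fzero    dⱼ≡true rewrite dⱼ≡true = refl
matchesOnto-[]-someTrue (true  ∷ d) (fsuc j) _       = refl
matchesOnto-[]-someTrue (false ∷ d) (fsuc j) dⱼ≡true = matchesOnto-[]-someTrue d j dⱼ≡true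

Represents : ∀ {b} → Vec Bool b → (ℕ → Bool) → Set
Represents d φ = ∀ j → lookup d j ≡ φ (toℕ j)

tabulate-represents : ∀ {b} (φ : ℕ → Bool) → Represents (tabulate {n = b} (φ ∘ toℕ)) φ
tabulate-represents φ = lookup∘tabulate (φ ∘ toℕ)

represents-cong : ∀ {b} {d : Vec Bool b} {φ ψ} → Represents d φ → (∀ j → j < b → φ j ≡ ψ j) →
                  Represents d ψ
represents-cong d~φ φ≗ψ j = trans (d~φ j) (φ≗ψ (toℕ j) (toℕ<n j))

represents-tail : ∀ {b x} {d : Vec Bool b} φ → Represents (x ∷ d) φ → Represents d (φ ∘ suc)
represents-tail φ d~φ = d~φ ∘ fsuc

represents-∖ : ∀ {b} {d r : Vec Bool b} {φ ψ} → Represents d φ → Represents r ψ →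
               Represents (d ∖ r) (λ j → φ j ∧ not (ψ j))
represents-∖ {d = d} {r} d~φ r~ψ j =
  trans (lookup-zipWith _ j d r) (cong₂ (λ δ x → δ ∧ not x) (d~φ j) (r~ψ j))

numTrue-represents : ∀ {b} (d : Vec Bool b) {φ} → Represents d φ → numTrue d ≡ sumRange 0 b (iverson ∘ φ)
numTrue-represents []      _ = refl
numTrue-represents {suc b} (x ∷ d) {φ} d~φ with φ 0 | d~φ fzero
... | true  | refl = cong suc tail
  where tail = trans (numTrue-represents d (represents-tail φ d~φ)) (sym (sumRange-shift 0 b (iverson ∘ φ)))
... | false | refl = trans (numTrue-represents d (represents-tail φ d~φ)) (sym (sumRange-shift 0 b (iverson ∘ φ)))

allTrue-zipWith : ∀ {b} (f : Bool → Bool → Bool) (u v : Vec Bool b) {φ ψ} → Represents u φ → Represents v ψ →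
  (∀ j → j < b → f (φ j) (ψ j) ≡ true) → allTrue (toList (zipWith f u v)) ≡ true
allTrue-zipWith f []      []      _    _    _   = refl
allTrue-zipWith f (x ∷ u) (y ∷ v) {φ} {ψ} u~φ v~ψ fφψ rewrite u~φ fzero | v~ψ fzero | fφψ 0 (s≤s z≤n) =
  allTrue-zipWith f u v (represents-tail φ u~φ) (represents-tail ψ v~ψ) (λ j j<b → fφψ (suc j) (s≤s j<b))

clear : ∀ {b} → ℕ → Vec Bool b → Vec Bool b
clear _       []      = []
clear zero    (δ ∷ d) = false ∷ d
clear (suc p) (δ ∷ d) = δ ∷ clear p d

represents-clear : ∀ {b} (d : Vec Bool b) {φ} p → Represents d φ →
                   Represents (clear p d) (λ j → φ j ∧ not (j ≡ᵇ p))
represents-clear (δ ∷ d)       zero    d~φ fzero    = sym (∧-zeroʳ _)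
represents-clear (δ ∷ d)       zero    d~φ (fsuc j) = trans (d~φ (fsuc j)) (sym (∧-identityʳ _))
represents-clear (δ ∷ d)       (suc p) d~φ fzero    = trans (d~φ fzero) (sym (∧-identityʳ _))
represents-clear (δ ∷ d) {φ}   (suc p) d~φ (fsuc j) = represents-clear d {φ ∘ suc} p (represents-tail φ d~φ) j

expand-sumRange : ∀ {b} (e d : Vec Bool b) (g : Vec Bool b → ℕ) {φ ψ} → Represents e φ → Represents d ψ →
  expand e d g ≡ sumRange 0 b (λ j → if φ j ∧ ψ j then g (clear j d) else 0)
expand-sumRange []      []      g _   _   = refl
expand-sumRange {suc b} (x ∷ e) (δ ∷ d) g {φ} {ψ} e~φ d~ψ =
  cong₂ _+_ (cong (λ β → if β then g (false ∷ d) else 0) (cong₂ _∧_ (e~φ fzero) (d~ψ fzero)))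
            (trans (expand-sumRange e d (λ d′ → g (δ ∷ d′)) {φ ∘ suc} {ψ ∘ suc}
                                    (represents-tail φ e~φ) (represents-tail ψ d~ψ))
                   (sym (sumRange-shift 0 b (λ j → if φ j ∧ ψ j then g (clear j (δ ∷ d)) else 0))))


module Ladder (c b : ℕ) where

  k : ℕ
  k = c + suc c

  -- Row i ≥ c gets the chords left over by the rows above it, which take c + 1 each, but at most
  -- c + 1 and at most i of them (a chord (i, j) has j < i); rows below c get none.
  chords : ℕ → ℕ
  chords i = if i <ᵇ c then 0 else (i ⊓ suc c) ⊓ (b ∸ (k ∸ suc i) * suc c)

  adjacent : ℕ → ℕ → Bool
  adjacent i j = (j <ᵇ chords i) ∨ ((j ≡ᵇ i) ∨ (j ≡ᵇ suc i))

  diagonal : ℕ → ℕ → Bool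
  diagonal i j = j ≡ᵇ i

  rowsFrom : (ℕ → ℕ → Bool) → ℕ → (r : ℕ) → Matrix r k
  rowsFrom f i zero    = []
  rowsFrom f i (suc r) = tabulate (f i ∘ toℕ) ∷ rowsFrom f (suc i) r

  ladder : Matrix k k
  ladder = rowsFrom adjacent 0 k

  identity : Matrix k k
  identity = rowsFrom diagonal 0 k

  chords-≤ : ∀ i → chords i ≤ i
  chords-≤ i with i <ᵇ c
  ... | true  = z≤n
  ... | false = ≤-trans (m⊓n≤m (i ⊓ suc c) _) (m⊓n≤m i (suc c))

  chords-≤-suc-c : ∀ i → chords i ≤ suc c
  chords-≤-suc-c i with i <ᵇ c
  ... | true  = z≤n
  ... | false = ≤-trans (m⊓n≤m (i ⊓ suc c) _) (m⊓n≤n i (suc c))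

  chords>0⇒c≤ : ∀ i → 0 < chords i → c ≤ i
  chords>0⇒c≤ i chords>0 with i <ᵇ c in eq
  ... | true  = contradiction chords>0 (<-irrefl refl)
  ... | false = ≮⇒≥ (λ i<c → subst T eq (<⇒<ᵇ i<c))

  -- The columns still free for the rows i, i + 1, … after the rows below i have been matched.
  available : ℕ → ℕ → ℕ → Bool
  available i u j = (j ≡ᵇ u) ∨ (i <ᵇ j)

  adjacent∧available : ∀ i u (g : ℕ → ℕ) → u ≤ i → ∀ j →
    (if adjacent i j ∧ available i u j then g j else 0) ≡
    (if j ≡ᵇ u then (if (u ≡ᵇ i) ∨ (u <ᵇ chords i) then g u else 0) else 0) +
    (if j ≡ᵇ suc i then g (suc i) else 0)
  adjacent∧available i u g u≤i j with j ≟ u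
  ... | yes refl rewrite ≡ᵇ-refl j | ≢⇒≡ᵇ-false {j} {suc i} (λ j≡1+i → <-irrefl j≡1+i (s≤s u≤i)) =
    trans (cong (λ β → if β then g j else 0) (∨-swap (j <ᵇ chords i) (j ≡ᵇ i))) (sym (+-identityʳ _))
    where
    ∨-swap : ∀ x y → (x ∨ (y ∨ false)) ∧ true ≡ y ∨ x
    ∨-swap x y rewrite ∨-identityʳ y | ∧-identityʳ (x ∨ y) = ∨-comm x y
  ... | no j≢u rewrite ≢⇒≡ᵇ-false j≢u with j ≟ suc i
  ...   | yes refl rewrite ≡ᵇ-refl i | <⇒<ᵇ-true (n<1+n i)
                         | ∨-zeroʳ (suc i ≡ᵇ i) | ∨-zeroʳ (suc i <ᵇ chords i) = refl
  ...   | no j≢1+i rewrite ≢⇒≡ᵇ-false j≢1+i with <-cmp j (suc i)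
  ...     | tri< j<1+i _ _ rewrite ≥⇒<ᵇ-false {i} {j} (≤-pred j<1+i) =
    cong (λ β → if β then g j else 0) (∧-zeroʳ _)
  ...     | tri≈ _ j≡1+i _ = contradiction j≡1+i j≢1+i
  ...     | tri> _ _ 1+i<j rewrite ≥⇒<ᵇ-false {j} {chords i} (≤-trans (chords-≤ i) (<⇒≤ (<-trans (n<1+n i) 1+i<j)))
                                 | ≢⇒≡ᵇ-false {j} {i} (λ j≡i → <-irrefl (sym j≡i) (<-trans (n<1+n i) 1+i<j)) = refl

  available-clear-self : ∀ i u → u ≤ i → ∀ j → available i u j ∧ not (j ≡ᵇ u) ≡ available (suc i) (suc i) j
  available-clear-self i u u≤i j with j ≟ u
  ... | yes refl rewrite ≡ᵇ-refl j | ≢⇒≡ᵇ-false {j} {suc i} (λ j≡1+i → <-irrefl j≡1+i (s≤s u≤i))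
                       | ≥⇒<ᵇ-false {suc i} {j} (m≤n⇒m≤1+n u≤i) = refl
  ... | no j≢u rewrite ≢⇒≡ᵇ-false j≢u | ∧-identityʳ (i <ᵇ j) with <-cmp j (suc i)
  ...   | tri< j<1+i _ _ rewrite ≥⇒<ᵇ-false {i} {j} (≤-pred j<1+i) | ≢⇒≡ᵇ-false (<⇒≢ j<1+i)
                               | ≥⇒<ᵇ-false {suc i} {j} (<⇒≤ j<1+i) = refl
  ...   | tri≈ _ refl _ rewrite <⇒<ᵇ-true (n<1+n i) | ≡ᵇ-refl i = refl
  ...   | tri> _ _ 1+i<j rewrite <⇒<ᵇ-true {i} {j} (<-trans (n<1+n i) 1+i<j) | <⇒<ᵇ-true 1+i<j =
    sym (∨-zeroʳ _)

  available-clear-next : ∀ i u → u ≤ i → ∀ j → available i u j ∧ not (j ≡ᵇ suc i) ≡ available (suc i) u j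
  available-clear-next i u u≤i j with <-cmp j (suc i)
  ... | tri< j<1+i _ _ rewrite ≥⇒<ᵇ-false {i} {j} (≤-pred j<1+i) | ≢⇒≡ᵇ-false (<⇒≢ j<1+i)
                             | ≥⇒<ᵇ-false {suc i} {j} (<⇒≤ j<1+i) = ∧-identityʳ _
  ... | tri≈ _ refl _ rewrite ≡ᵇ-refl i | ≢⇒≡ᵇ-false {suc i} {u} (λ 1+i≡u → <-irrefl (sym 1+i≡u) (s≤s u≤i))
                             | ≥⇒<ᵇ-false {suc i} {suc i} ≤-refl = ∧-zeroʳ _
  ... | tri> _ _ 1+i<j rewrite ≢⇒≡ᵇ-false {j} {suc i} (λ j≡1+i → <-irrefl (sym j≡1+i) 1+i<j)
                             | ≢⇒≡ᵇ-false {j} {u} (λ j≡u → <-irrefl (sym j≡u) (≤-trans (s≤s u≤i) (<⇒≤ 1+i<j)))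
                             | <⇒<ᵇ-true {i} {j} (<-trans (n<1+n i) 1+i<j) | <⇒<ᵇ-true 1+i<j = refl

  -- Matchings of the rows i, …, i + r − 1 onto available i u: for u = i the diagonal one and one per
  -- chord (j, t) with t ≥ i; for u < i one per row j whose chords reach column u.
  matchCount : ℕ → ℕ → ℕ → ℕ
  matchCount i r u = if u ≡ᵇ i then suc (sumRange i r (λ j → chords j ∸ i))
                     else sumRange i r (λ j → iverson (u <ᵇ chords j))

  matchCount-self : ∀ i r → matchCount i r i ≡ suc (sumRange i r (λ j → chords j ∸ i))
  matchCount-self i r rewrite ≡ᵇ-refl i = refl

  matchCount-other : ∀ i r u → u ≢ i → matchCount i r u ≡ sumRange i r (λ j → iverson (u <ᵇ chords j))
  matchCount-other i r u u≢i rewrite ≢⇒≡ᵇ-false u≢i = refl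

  matchCount-step-self : ∀ i r → matchCount (suc i) r (suc i) + matchCount (suc i) r i ≡ matchCount i (suc r) i
  matchCount-step-self i r = begin
    matchCount (suc i) r (suc i) + matchCount (suc i) r i
      ≡⟨ cong₂ _+_ (matchCount-self (suc i) r) (matchCount-other (suc i) r i (<⇒≢ (n<1+n i))) ⟩
    suc (sumRange (suc i) r (λ j → chords j ∸ suc i) + sumRange (suc i) r (λ j → iverson (i <ᵇ chords j)))
      ≡⟨ cong suc (sym (sumRange-+ (suc i) r _ _)) ⟩
    suc (sumRange (suc i) r (λ j → (chords j ∸ suc i) + iverson (i <ᵇ chords j)))
      ≡⟨ cong suc (sumRange-cong (suc i) r (λ j _ _ → sym (∸≡∸-suc+[<] (chords j) i))) ⟩
    suc (sumRange (suc i) r (λ j → chords j ∸ i))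
      ≡⟨ cong (λ x → suc (x + sumRange (suc i) r (λ j → chords j ∸ i))) (sym (m≤n⇒m∸n≡0 (chords-≤ i))) ⟩
    suc (sumRange i (suc r) (λ j → chords j ∸ i))
      ≡⟨ sym (matchCount-self i (suc r)) ⟩
    matchCount i (suc r) i ∎
    where open ≡-Reasoning

  -- Here it matters that all chord intervals contain the row c: a chord in row i forces c ≤ i,
  -- so no chord of a row above i reaches a column beyond i.
  matchCount-step-below : ∀ i r u → u < i →
    (if u <ᵇ chords i then matchCount (suc i) r (suc i) else 0) + matchCount (suc i) r u ≡ matchCount i (suc r) u
  matchCount-step-below i r u u<i
    rewrite matchCount-other (suc i) r u (<⇒≢ (m<n⇒m<1+n u<i)) | matchCount-other i (suc r) u (<⇒≢ u<i)
    with u <ᵇ chords i in u<chords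
  ... | false = refl
  ... | true  = cong (_+ sumRange (suc i) r (λ j → iverson (u <ᵇ chords j)))
                     (trans (matchCount-self (suc i) r) (cong suc (sumRange-zero (suc i) r noChords)))
    where
    c≤i : c ≤ i
    c≤i = chords>0⇒c≤ i (<-≤-trans (s≤s z≤n) (<ᵇ⇒< u (chords i) (subst T (sym u<chords) _)))
    noChords : ∀ j → suc i ≤ j → j < suc i + r → chords j ∸ suc i ≡ 0
    noChords j _ _ = m≤n⇒m∸n≡0 (≤-trans (chords-≤-suc-c j) (s≤s c≤i))

  matchCount-step : ∀ i r u → u ≤ i →
    (if (u ≡ᵇ i) ∨ (u <ᵇ chords i) then matchCount (suc i) r (suc i) else 0) + matchCount (suc i) r u
      ≡ matchCount i (suc r) u
  matchCount-step i r u u≤i with m≤n⇒m<n∨m≡n u≤i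
  ... | inj₂ refl = trans (cong (λ β → stepSum β u) (≡ᵇ-refl u)) (matchCount-step-self u r)
    where stepSum = λ β u → (if β ∨ (u <ᵇ chords u) then matchCount (suc u) r (suc u) else 0) + matchCount (suc u) r u
  ... | inj₁ u<i  = trans (cong stepSum (≢⇒≡ᵇ-false (<⇒≢ u<i))) (matchCount-step-below i r u u<i)
    where stepSum = λ β → (if β ∨ (u <ᵇ chords i) then matchCount (suc i) r (suc i) else 0) + matchCount (suc i) r u

  nothingAvailable : (d : Vec Bool k) → Represents d (available k k) → ∀ j → lookup d j ≡ false
  nothingAvailable d d~ j rewrite d~ j | ≢⇒≡ᵇ-false (<⇒≢ (toℕ<n j)) | ≥⇒<ᵇ-false {k} {toℕ j} (<⇒≤ (toℕ<n j)) =
    refl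

  numMatchingsOnto-noRows : ∀ u (d : Vec Bool k) → u ≤ k → Represents d (available k u) →
                            numMatchingsOnto [] d ≡ matchCount k 0 u
  numMatchingsOnto-noRows u d u≤k d~ with m≤n⇒m<n∨m≡n u≤k
  ... | inj₂ refl = begin
    numMatchingsOnto [] d             ≡⟨ numMatchingsOnto-[] d ⟩
    iverson (matchesOntoᵇ [] d [])    ≡⟨ cong iverson (matchesOnto-[]-allFalse d unavailable) ⟩
    1                                 ≡⟨ sym (matchCount-self k 0) ⟩
    matchCount k 0 k                  ∎
    where
    open ≡-Reasoning
    unavailable = nothingAvailable d d~
  ... | inj₁ u<k = begin
    numMatchingsOnto [] d             ≡⟨ numMatchingsOnto-[] d ⟩
    iverson (matchesOntoᵇ [] d [])    ≡⟨ cong iverson (matchesOnto-[]-someTrue d (fromℕ< u<k) uAvailable) ⟩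
    0                                 ≡⟨ sym (matchCount-other k 0 u (<⇒≢ u<k)) ⟩
    matchCount k 0 u                  ∎
    where
    open ≡-Reasoning
    uAvailable : lookup d (fromℕ< u<k) ≡ true
    uAvailable rewrite d~ (fromℕ< u<k) | toℕ-fromℕ< u<k | ≡ᵇ-refl u = refl

  sumRange-indicator-matchCount : ∀ r i u → suc i + r ≡ k → u ≤ i →
    sumRange 0 k (λ j → if j ≡ᵇ suc i then matchCount (suc i) r u else 0) ≡ matchCount (suc i) r u
  sumRange-indicator-matchCount zero    i u 1+i+0≡k u≤i =
    trans (sumRange-indicator-≥ k (suc i) _ (≤-reflexive (sym (trans (sym (+-identityʳ (suc i))) 1+i+0≡k))))
          (sym (matchCount-other (suc i) 0 u (<⇒≢ (s≤s u≤i))))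
  sumRange-indicator-matchCount (suc r) i u 1+i+r≡k u≤i =
    sumRange-indicator k (suc i) _ (subst (suc i <_) 1+i+r≡k (<-+-suc (suc i) r))

  expand-ladderRow : ∀ i u (g : Vec Bool k → ℕ) d → u ≤ i → u < k → Represents d (available i u) →
    expand (tabulate (adjacent i ∘ toℕ)) d g ≡
    (if (u ≡ᵇ i) ∨ (u <ᵇ chords i) then g (clear u d) else 0) +
    sumRange 0 k (λ j → if j ≡ᵇ suc i then g (clear (suc i) d) else 0)
  expand-ladderRow i u g d u≤i u<k d~ = begin
    expand row d g
      ≡⟨ expand-sumRange row d g {adjacent i} {available i u} (tabulate-represents (adjacent i)) d~ ⟩
    sumRange 0 k (λ j → if adjacent i j ∧ available i u j then g (clear j d) else 0)
      ≡⟨ sumRange-cong 0 k (λ j _ _ → adjacent∧available i u (λ j → g (clear j d)) u≤i j) ⟩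
    sumRange 0 k (λ j → (if j ≡ᵇ u then takeU else 0) + (if j ≡ᵇ suc i then next else 0))
      ≡⟨ sumRange-+ 0 k (λ j → if j ≡ᵇ u then takeU else 0) _ ⟩
    sumRange 0 k (λ j → if j ≡ᵇ u then takeU else 0) + sumRange 0 k (λ j → if j ≡ᵇ suc i then next else 0)
      ≡⟨ cong (_+ sumRange 0 k (λ j → if j ≡ᵇ suc i then next else 0)) (sumRange-indicator k u takeU u<k) ⟩
    takeU + sumRange 0 k (λ j → if j ≡ᵇ suc i then next else 0) ∎
    where
    open ≡-Reasoning
    row = tabulate {n = k} (adjacent i ∘ toℕ)
    takeU = if (u ≡ᵇ i) ∨ (u <ᵇ chords i) then g (clear u d) else 0
    next = g (clear (suc i) d)

  numMatchingsOnto-rowsFrom : ∀ r i u → i + r ≡ k → u ≤ i → ∀ d → Represents d (available i u) →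
    numMatchingsOnto (rowsFrom adjacent i r) d ≡ matchCount i r u
  numMatchingsOnto-rowsFrom zero i u i+0≡k u≤i d d~ with trans (sym (+-identityʳ i)) i+0≡k
  ... | refl = numMatchingsOnto-noRows u d u≤i d~
  numMatchingsOnto-rowsFrom (suc r) i u i+1+r≡k u≤i d d~ = begin
    numMatchingsOnto (row ∷ rows) d
      ≡⟨ numMatchingsOnto-∷ row rows d ⟩
    expand row d g
      ≡⟨ expand-ladderRow i u g d u≤i (≤-<-trans u≤i (subst (i <_) i+1+r≡k (<-+-suc i r))) d~ ⟩
    (if i~u then g (clear u d) else 0) + sumRange 0 k (λ j → if j ≡ᵇ suc i then g (clear (suc i) d) else 0)
      ≡⟨ cong₂ (λ x y → (if i~u then x else 0) + sumRange 0 k (λ j → if j ≡ᵇ suc i then y else 0))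
               takeU takeNext ⟩
    (if i~u then matchCount (suc i) r (suc i) else 0) +
    sumRange 0 k (λ j → if j ≡ᵇ suc i then matchCount (suc i) r u else 0)
      ≡⟨ cong ((if i~u then matchCount (suc i) r (suc i) else 0) +_)
              (sumRange-indicator-matchCount r i u 1+i+r≡k u≤i) ⟩
    (if i~u then matchCount (suc i) r (suc i) else 0) + matchCount (suc i) r u
      ≡⟨ matchCount-step i r u u≤i ⟩
    matchCount i (suc r) u ∎
    where
    open ≡-Reasoning
    row = tabulate {n = k} (adjacent i ∘ toℕ)
    rows = rowsFrom adjacent (suc i) r
    g = numMatchingsOnto rows
    i~u = (u ≡ᵇ i) ∨ (u <ᵇ chords i)
    1+i+r≡k : suc i + r ≡ k
    1+i+r≡k = trans (sym (+-suc i r)) i+1+r≡k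
    takeU : g (clear u d) ≡ matchCount (suc i) r (suc i)
    takeU = numMatchingsOnto-rowsFrom r (suc i) (suc i) 1+i+r≡k ≤-refl (clear u d)
      (represents-cong {d = clear u d} (represents-clear d {available i u} u d~)
                       (λ j _ → available-clear-self i u u≤i j))
    takeNext : g (clear (suc i) d) ≡ matchCount (suc i) r u
    takeNext = numMatchingsOnto-rowsFrom r (suc i) u 1+i+r≡k (m≤n⇒m≤1+n u≤i) (clear (suc i) d)
      (represents-cong {d = clear (suc i) d} (represents-clear d {available i u} (suc i) d~)
                       (λ j _ → available-clear-next i u u≤i j))

  allAvailable : Represents (replicate k true) (available 0 0)
  allAvailable j with toℕ j
  ... | zero  = lookup-replicate j true
  ... | suc _ = lookup-replicate j true

  numPerfectMatchings-ladder : numPerfectMatchings (bipartite k k ladder) ≡ suc (sumRange 0 k chords)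
  numPerfectMatchings-ladder =
    trans (numPerfectMatchings-byRows ladder)
          (numMatchingsOnto-rowsFrom k 0 0 refl z≤n (replicate k true) allAvailable)

  chords-≥ : ∀ i → c ≤ i → chords i ≡ (i ⊓ suc c) ⊓ (b ∸ (k ∸ suc i) * suc c)
  chords-≥ i c≤i rewrite ≥⇒<ᵇ-false {i} {c} c≤i = refl

  k∸[1+i]≡r : ∀ i r → i + suc r ≡ k → k ∸ suc i ≡ r
  k∸[1+i]≡r i r i+1+r≡k = trans (cong (_∸ suc i) (trans (sym i+1+r≡k) (+-suc i r))) (m+n∸m≡n i r)

  sum-chords-top : ∀ r i → suc c ≤ i → i + r ≡ k → sumRange i r chords ≡ b ⊓ (r * suc c)
  sum-chords-top zero    i _     _       = sym (⊓-zeroʳ b)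
  sum-chords-top (suc r) i 1+c≤i i+1+r≡k
    rewrite sum-chords-top r (suc i) (m≤n⇒m≤1+n 1+c≤i) (trans (sym (+-suc i r)) i+1+r≡k)
          | chords-≥ i (<⇒≤ 1+c≤i) | m≥n⇒m⊓n≡n 1+c≤i | k∸[1+i]≡r i r i+1+r≡k
    = m⊓[n∸o]+n⊓o≡n⊓[m+o] (suc c) b (r * suc c)

  sum-chords-bottom : ∀ i r → i + r ≤ c → sumRange i r chords ≡ 0
  sum-chords-bottom i r i+r≤c = sumRange-zero i r noChords
    where
    noChords : ∀ j → i ≤ j → j < i + r → chords j ≡ 0
    noChords j _ j<i+r rewrite <⇒<ᵇ-true (<-≤-trans j<i+r i+r≤c) = refl

  sum-chords : b ≤ c + c * suc c → sumRange 0 k chords ≡ b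
  sum-chords b≤capacity = begin
    sumRange 0 (c + suc c) chords
      ≡⟨ sumRange-++ 0 c (suc c) chords ⟩
    sumRange 0 c chords + (chords c + sumRange (suc c) c chords)
      ≡⟨ cong₂ (λ x y → x + (y + sumRange (suc c) c chords))
               (sum-chords-bottom 0 c ≤-refl) (chords-≥ c ≤-refl) ⟩
    (c ⊓ suc c) ⊓ (b ∸ (k ∸ suc c) * suc c) + sumRange (suc c) c chords
      ≡⟨ cong₂ (λ x y → x ⊓ (b ∸ y * suc c) + sumRange (suc c) c chords)
               (m≤n⇒m⊓n≡m (n≤1+n c)) (k∸[1+i]≡r c c refl) ⟩
    c ⊓ (b ∸ c * suc c) + sumRange (suc c) c chords
      ≡⟨ cong (c ⊓ (b ∸ c * suc c) +_) (sum-chords-top c (suc c) ≤-refl (+-comm (suc c) c)) ⟩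
    c ⊓ (b ∸ c * suc c) + b ⊓ (c * suc c)
      ≡⟨ m⊓[n∸o]+n⊓o≡n⊓[m+o] c b (c * suc c) ⟩
    b ⊓ (c + c * suc c)
      ≡⟨ m≤n⇒m⊓n≡m b≤capacity ⟩
    b ∎
    where open ≡-Reasoning

  numTrue-rowsFrom : ∀ f i r →
    Vec.sum (Vec.map numTrue (rowsFrom f i r)) ≡ sumRange i r (λ q → sumRange 0 k (iverson ∘ f q))
  numTrue-rowsFrom f i zero    = refl
  numTrue-rowsFrom f i (suc r) =
    cong₂ _+_ (numTrue-represents (tabulate {n = k} (f i ∘ toℕ)) {f i} (tabulate-represents (f i)))
              (numTrue-rowsFrom f (suc i) r)

  iverson-adjacent : ∀ q j →
    iverson (adjacent q j) ≡ iverson (j <ᵇ chords q) + (iverson (j ≡ᵇ q) + iverson (j ≡ᵇ suc q))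
  iverson-adjacent q j with <-cmp j q
  ... | tri< j<q _ _ rewrite ≢⇒≡ᵇ-false (<⇒≢ j<q) | ≢⇒≡ᵇ-false (<⇒≢ (m<n⇒m<1+n j<q))
    with j <ᵇ chords q
  ...   | true  = refl
  ...   | false = refl
  iverson-adjacent q j | tri≈ _ refl _
    rewrite ≡ᵇ-refl j | ≥⇒<ᵇ-false {j} {chords j} (chords-≤ j) | ≢⇒≡ᵇ-false (<⇒≢ (n<1+n j)) = refl
  iverson-adjacent q j | tri> _ _ q<j
    rewrite ≢⇒≡ᵇ-false (<⇒≢ q<j ∘ sym) | ≥⇒<ᵇ-false {j} {chords q} (≤-trans (chords-≤ q) (<⇒≤ q<j)) = refl

  degree : ∀ q → q < k → sumRange 0 k (iverson ∘ adjacent q) ≡ chords q + (1 + iverson (suc q <ᵇ k))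
  degree q q<k = begin
    sumRange 0 k (iverson ∘ adjacent q)
      ≡⟨ sumRange-cong 0 k (λ j _ _ → iverson-adjacent q j) ⟩
    sumRange 0 k (λ j → iverson (j <ᵇ chords q) + (iverson (j ≡ᵇ q) + iverson (j ≡ᵇ suc q)))
      ≡⟨ trans (sumRange-+ 0 k (λ j → iverson (j <ᵇ chords q)) _)
               (cong (sumRange 0 k (λ j → iverson (j <ᵇ chords q)) +_)
                     (sumRange-+ 0 k (λ j → iverson (j ≡ᵇ q)) _)) ⟩
    sumRange 0 k (λ j → iverson (j <ᵇ chords q)) +
    (sumRange 0 k (λ j → iverson (j ≡ᵇ q)) + sumRange 0 k (λ j → iverson (j ≡ᵇ suc q)))
      ≡⟨ cong₂ _+_ (sumRange-below k (chords q) (≤-trans (chords-≤ q) (<⇒≤ q<k)))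
                   (cong₂ _+_ (sumRange-indicator k q 1 q<k) nextColumn) ⟩
    chords q + (1 + iverson (suc q <ᵇ k)) ∎
    where
    open ≡-Reasoning
    nextColumn : sumRange 0 k (λ j → iverson (j ≡ᵇ suc q)) ≡ iverson (suc q <ᵇ k)
    nextColumn with suc q <? k
    ... | yes 1+q<k rewrite <⇒<ᵇ-true 1+q<k = sumRange-indicator k (suc q) 1 1+q<k
    ... | no  1+q≮k rewrite ≥⇒<ᵇ-false {suc q} {k} (≮⇒≥ 1+q≮k) =
      sumRange-indicator-≥ k (suc q) 1 (≮⇒≥ 1+q≮k)

  path-length : ∀ n → sumRange 0 (suc n) (λ q → 1 + iverson (suc q <ᵇ suc n)) ≡ suc n + n
  path-length n = begin
    sumRange 0 (suc n) (λ q → 1 + iverson (q <ᵇ n))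
      ≡⟨ sumRange-+ 0 (suc n) (λ _ → 1) _ ⟩
    sumRange 0 (suc n) (λ _ → 1) + sumRange 0 (suc n) (λ q → iverson (q <ᵇ n))
      ≡⟨ cong₂ _+_ (trans (sumRange-const 0 (suc n) 1) (*-identityʳ (suc n)))
                   (sumRange-below (suc n) n (n≤1+n n)) ⟩
    suc n + n ∎
    where open ≡-Reasoning

  numEdges-ladder : b ≤ c + c * suc c → numEdges (bipartite k k ladder) ≡ b + (suc (c + c) + (c + c))
  numEdges-ladder b≤capacity = begin
    Vec.sum (Vec.map numTrue ladder)
      ≡⟨ numTrue-rowsFrom adjacent 0 k ⟩
    sumRange 0 k (λ q → sumRange 0 k (iverson ∘ adjacent q))
      ≡⟨ sumRange-cong 0 k (λ q _ q<k → degree q q<k) ⟩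
    sumRange 0 k (λ q → chords q + (1 + iverson (suc q <ᵇ k)))
      ≡⟨ sumRange-+ 0 k chords _ ⟩
    sumRange 0 k chords + sumRange 0 k (λ q → 1 + iverson (suc q <ᵇ k))
      ≡⟨ cong₂ _+_ (sum-chords b≤capacity)
                   (trans (cong (λ n → sumRange 0 n (λ q → 1 + iverson (suc q <ᵇ n))) (+-suc c c))
                          (path-length (c + c))) ⟩
    b + (suc (c + c) + (c + c)) ∎
    where open ≡-Reasoning

  identity-matchesOnto : ∀ r i → i + r ≡ k → ∀ d → Represents d (available i i) →
    matchesOntoᵇ (rowsFrom adjacent i r) d (rowsFrom diagonal i r) ≡ true
  identity-matchesOnto zero    i i+0≡k d d~ with trans (sym (+-identityʳ i)) i+0≡k
  ... | refl = matchesOnto-[]-allFalse d (nothingAvailable d d~)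
  identity-matchesOnto (suc r) i i+1+r≡k d d~ =
    cong₂ _∧_ matchingRow
              (identity-matchesOnto r (suc i) (trans (sym (+-suc i r)) i+1+r≡k) (d ∖ unit)
                (represents-cong {d = d ∖ unit}
                  (represents-∖ {d = d} {unit} {available i i} {diagonal i} d~ (tabulate-represents (diagonal i)))
                  (λ j _ → available-clear-self i i ≤-refl j)))
    where
    row  = tabulate {n = k} (adjacent i ∘ toℕ)
    unit = tabulate {n = k} (diagonal i ∘ toℕ)
    i<k : i < k
    i<k = subst (i <_) i+1+r≡k (<-+-suc i r)
    diagonal-⊆-adjacent : ∀ j → not (diagonal i j) ∨ adjacent i j ≡ true
    diagonal-⊆-adjacent j with j ≟ i
    ... | yes refl rewrite ≡ᵇ-refl j = ∨-zeroʳ (j <ᵇ chords j)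
    ... | no  j≢i  rewrite ≢⇒≡ᵇ-false j≢i = refl
    diagonal-⊆-available : ∀ j → not (diagonal i j) ∨ available i i j ≡ true
    diagonal-⊆-available j with j ≟ i
    ... | yes refl rewrite ≡ᵇ-refl j = refl
    ... | no  j≢i  rewrite ≢⇒≡ᵇ-false j≢i = refl
    matchingRow : isMatchingRowᵇ row d unit ≡ true
    matchingRow = cong₂ _∧_
      (allTrue-zipWith _ row unit {adjacent i} {diagonal i}
                       (tabulate-represents (adjacent i)) (tabulate-represents (diagonal i))
                       (λ j _ → diagonal-⊆-adjacent j))
      (cong₂ _∧_ (cong (_≡ᵇ 1) (trans (numTrue-represents unit {diagonal i} (tabulate-represents (diagonal i)))
                                      (sumRange-indicator k i 1 i<k)))
                 (allTrue-zipWith _ d unit {available i i} {diagonal i} d~ (tabulate-represents (diagonal i))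
                                  (λ j _ → diagonal-⊆-available j)))

  identity-isPerfectMatching : IsPerfectMatching (bipartite k k ladder) identity
  identity-isPerfectMatching =
    subst T (sym (trans (isPerfectMatching-byRows ladder identity)
                        (identity-matchesOnto k 0 refl (replicate k true) allAvailable))) tt

  lookup-rowsFrom : ∀ f s r (i : Fin r) (j : Fin k) → lookup (lookup (rowsFrom f s r) i) j ≡ f (s + toℕ i) (toℕ j)
  lookup-rowsFrom f s (suc r) fzero    j =
    trans (lookup∘tabulate (f s ∘ toℕ) j) (cong (λ s′ → f s′ (toℕ j)) (sym (+-identityʳ s)))
  lookup-rowsFrom f s (suc r) (fsuc i) j =
    trans (lookup-rowsFrom f (suc s) r i j) (cong (λ s′ → f s′ (toℕ j)) (sym (+-suc s (toℕ i))))

  graph : BipartiteGraph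
  graph = bipartite k k ladder

  _⟶_ : Vertex graph → Vertex graph → Set
  _⟶_ = Arc graph identity

  _⟶*_ : Vertex graph → Vertex graph → Set
  _⟶*_ = Star _⟶_

  matchedArc : ∀ i → inj₁ i ⟶ inj₂ i
  matchedArc i = subst T (sym (trans (lookup-rowsFrom diagonal 0 k i i) (≡ᵇ-refl (toℕ i)))) tt

  unmatchedArc : ∀ i j → adjacent (toℕ i) (toℕ j) ≡ true → toℕ j ≢ toℕ i → inj₂ j ⟶ inj₁ i
  unmatchedArc i j i~j j≢i = subst T (sym isArc) tt
    where
    isArc : entry ladder i j ∧ not (entry identity i j) ≡ true
    isArc rewrite lookup-rowsFrom adjacent 0 k i j | lookup-rowsFrom diagonal 0 k i j | i~j | ≢⇒≡ᵇ-false j≢i =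
      refl

  pathArc : ∀ i j → toℕ j ≡ suc (toℕ i) → inj₂ j ⟶ inj₁ i
  pathArc i j j≡1+i = unmatchedArc i j i~j (λ j≡i → <-irrefl (sym j≡i) (≤-reflexive (sym j≡1+i)))
    where
    i~j : adjacent (toℕ i) (toℕ j) ≡ true
    i~j rewrite j≡1+i | ≡ᵇ-refl (toℕ i) | ∨-zeroʳ (suc (toℕ i) ≡ᵇ toℕ i) = ∨-zeroʳ _

  descend : ∀ n (i j : Fin k) → toℕ i ≡ n + toℕ j → inj₁ i ⟶* inj₁ j
  descend zero    i j i≡j     = subst (λ j → inj₁ i ⟶* inj₁ j) (toℕ-injective i≡j) ε
  descend (suc n) i j i≡1+n+j = begin
    inj₁ i ⟶⟨ matchedArc i ⟩
    inj₂ i ⟶⟨ pathArc p i i≡1+p ⟩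
    inj₁ p ⟶*⟨ descend n p j (toℕ-fromℕ< n+j<k) ⟩
    inj₁ j ∎
    where
    open StarReasoning _⟶_
    n+j<k : n + toℕ j < k
    n+j<k = <-trans (n<1+n _) (subst (_< k) i≡1+n+j (toℕ<n i))
    p = fromℕ< n+j<k
    i≡1+p : toℕ i ≡ suc (toℕ p)
    i≡1+p = trans i≡1+n+j (cong suc (sym (toℕ-fromℕ< n+j<k)))

  bottom : Fin k
  bottom = fromℕ< {0} (≤-trans (s≤s z≤n) (m≤n+m (suc c) c))

  top : Fin k
  top = fromℕ< {c + c} (+-monoʳ-< c (n<1+n c))

  descend-bottom : ∀ i → inj₁ i ⟶* inj₁ bottom
  descend-bottom i =
    descend (toℕ i) i bottom (sym (trans (cong (toℕ i +_) (toℕ-fromℕ< _)) (+-identityʳ (toℕ i))))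

  descend-top : ∀ i → inj₁ top ⟶* inj₁ i
  descend-top i = descend (c + c ∸ toℕ i) top i (trans (toℕ-fromℕ< _) (sym (m∸n+n≡m i≤c+c)))
    where
    i≤c+c : toℕ i ≤ c + c
    i≤c+c = ≤-pred (subst (toℕ i <_) (+-suc c c) (toℕ<n i))

  -- The arc R₀ → L₂c closing the Hamiltonian cycle is the chord (2c, 0).
  module _ (1≤c : 1 ≤ c) (1≤b : 1 ≤ b) where

    topChord : 0 < chords (c + c)
    topChord rewrite chords-≥ (c + c) (m≤m+n c c)
                   | k∸[1+i]≡r (c + c) 0 (trans (+-assoc c c 1) (cong (c +_) (+-comm c 1))) =
      ⊓-pres-m< (⊓-pres-m< (≤-trans 1≤c (m≤m+n c c)) (s≤s z≤n)) 1≤b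

    wrapArc : ∀ j → toℕ j ≡ 0 → inj₂ j ⟶ inj₁ top
    wrapArc j j≡0 =
      unmatchedArc top j top~j (λ j≡top → <-irrefl (trans (sym j≡0) (trans j≡top (toℕ-fromℕ< _))) 0<c+c)
      where
      0<c+c : 0 < c + c
      0<c+c = ≤-trans 1≤c (m≤m+n c c)
      top~j : adjacent (toℕ top) (toℕ j) ≡ true
      top~j rewrite toℕ-fromℕ< (+-monoʳ-< c (n<1+n c)) | j≡0 | <⇒<ᵇ-true topChord = refl

    ascend-right : ∀ j t → toℕ j ≡ t → inj₂ j ⟶* inj₁ bottom
    ascend-right j zero    j≡0   = begin
      inj₂ j   ⟶⟨ wrapArc j j≡0 ⟩
      inj₁ top ⟶*⟨ descend-bottom top ⟩
      inj₁ bottom ∎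
      where open StarReasoning _⟶_
    ascend-right j (suc t) j≡1+t = begin
      inj₂ j ⟶⟨ pathArc p j (trans j≡1+t (cong suc (sym (toℕ-fromℕ< t<k)))) ⟩
      inj₁ p ⟶*⟨ descend-bottom p ⟩
      inj₁ bottom ∎
      where
      open StarReasoning _⟶_
      t<k : t < k
      t<k = <-trans (n<1+n t) (subst (_< k) j≡1+t (toℕ<n j))
      p = fromℕ< t<k

    toBottom : ∀ v → v ⟶* inj₁ bottom
    toBottom (inj₁ i) = descend-bottom i
    toBottom (inj₂ j) = ascend-right j (toℕ j) refl

    fromBottom : ∀ v → inj₁ bottom ⟶* v
    fromBottom (inj₁ i) = begin
      inj₁ bottom ⟶⟨ matchedArc bottom ⟩
      inj₂ bottom ⟶⟨ wrapArc bottom (toℕ-fromℕ< _) ⟩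
      inj₁ top    ⟶*⟨ descend-top i ⟩
      inj₁ i      ∎
      where open StarReasoning _⟶_
    fromBottom (inj₂ j) = begin
      inj₁ bottom ⟶*⟨ fromBottom (inj₁ j) ⟩
      inj₁ j      ⟶⟨ matchedArc j ⟩
      inj₂ j      ∎
      where open StarReasoning _⟶_

    graph-stronglyConnected : StronglyConnected graph
    graph-stronglyConnected = strong identity identity-isPerfectMatching (λ u v → toBottom u ◅◅ fromBottom v)


ladder-realises : ∀ c b → 1 ≤ b → b ≤ c + c * suc c →
  ∃[ G ] (numVertices G ≡ 2 + c * 4 × numEdges G ≡ b + (1 + c * 4) × StronglyConnected G
          × numPerfectMatchings G ≡ suc b)
ladder-realises zero    b 1≤b b≤0 = contradiction (≤-trans 1≤b b≤0) λ ()
ladder-realises (suc c) b 1≤b b≤capacity =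
  graph , vertices c , trans (numEdges-ladder b≤capacity) (cong (b +_) (edges c)) ,
  graph-stronglyConnected (s≤s z≤n) 1≤b , trans numPerfectMatchings-ladder (cong suc (sum-chords b≤capacity))
  where
  open Ladder (suc c) b
  vertices : ∀ c → (suc c + suc (suc c)) + (suc c + suc (suc c)) ≡ 2 + suc c * 4
  vertices = solve-∀
  edges : ∀ c → suc (suc c + suc c) + (suc c + suc c) ≡ 1 + suc c * 4
  edges = solve-∀

n+2≡4[1+c]⇒n≡2+4c : ∀ n c → n + 2 ≡ suc c * 4 → n ≡ 2 + c * 4
n+2≡4[1+c]⇒n≡2+4c n c eq = +-cancelʳ-≡ 2 n (2 + c * 4) (trans eq (lemma c))
  where
  lemma : ∀ c → suc c * 4 ≡ (2 + c * 4) + 2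
  lemma = solve-∀

m≤capacity+n∸1 : ∀ c m → 16 * m + 28 ≤ (2 + c * 4) * (2 + c * 4) + 20 * (2 + c * 4) →
                 m ≤ c + c * suc c + (1 + c * 4)
m≤capacity+n∸1 c m bound = *-cancelˡ-≤ 16 (+-cancelʳ-≤ 28 (16 * m) _ (≤-trans bound (≤-reflexive (lemma c))))
  where
  lemma : ∀ c → (2 + c * 4) * (2 + c * 4) + 20 * (2 + c * 4) ≡ 16 * (c + c * suc c + (1 + c * 4)) + 28
  lemma = solve-∀

b+[n∸1]+2≡1+b+n : ∀ b c → b + (1 + c * 4) + 2 ≡ suc b + (2 + c * 4)
b+[n∸1]+2≡1+b+n = solve-∀

ladder-realises-4c+2 : ∀ c m → 2 + c * 4 ≤ m → 16 * m + 28 ≤ (2 + c * 4) * (2 + c * 4) + 20 * (2 + c * 4) →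
  ∃[ G ] (numVertices G ≡ 2 + c * 4 × numEdges G ≡ m × StronglyConnected G
          × numPerfectMatchings G ≡ m + 2 ∸ (2 + c * 4))
ladder-realises-4c+2 c m n≤m bound =
  let G , vertices , edges , connected , matchings = ladder-realises c b 1≤b b≤capacity
  in  G , vertices , trans edges b+[n∸1]≡m , connected , trans matchings (sym m+2∸n≡1+b)
  where
  b = m ∸ (1 + c * 4)
  1≤b : 1 ≤ b
  1≤b = subst (_≤ b) (m+n∸n≡m 1 (1 + c * 4)) (∸-monoˡ-≤ (1 + c * 4) n≤m)
  b≤capacity : b ≤ c + c * suc c
  b≤capacity = subst (b ≤_) (m+n∸n≡m (c + c * suc c) (1 + c * 4))
                            (∸-monoˡ-≤ (1 + c * 4) (m≤capacity+n∸1 c m bound))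
  b+[n∸1]≡m : b + (1 + c * 4) ≡ m
  b+[n∸1]≡m = m∸n+n≡m (≤-trans (n≤1+n _) n≤m)
  m+2∸n≡1+b : m + 2 ∸ (2 + c * 4) ≡ suc b
  m+2∸n≡1+b = begin
    m + 2 ∸ (2 + c * 4)                ≡⟨ cong (λ x → x + 2 ∸ (2 + c * 4)) (sym b+[n∸1]≡m) ⟩
    b + (1 + c * 4) + 2 ∸ (2 + c * 4)  ≡⟨ cong (_∸ (2 + c * 4)) (b+[n∸1]+2≡1+b+n b c) ⟩
    suc b + (2 + c * 4) ∸ (2 + c * 4)  ≡⟨ m+n∸n≡m (suc b) (2 + c * 4) ⟩
    suc b                              ∎
    where open ≡-Reasoning

mainTheorem2 : (n m : ℕ) → 4 ∣ n + 2 → n ≤ m → 16 * m + 28 ≤ n * n + 20 * n →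
    ∃[ G ] (numVertices G ≡ n × numEdges G ≡ m × StronglyConnected G
            × numPerfectMatchings G ≡ m + 2 ∸ n)
mainTheorem2 n m (divides zero    n+2≡0)       _   _     = contradiction (trans (+-comm 2 n) n+2≡0) λ ()
mainTheorem2 n m (divides (suc c) n+2≡4[1+c]) n≤m bound with n+2≡4[1+c]⇒n≡2+4c n c n+2≡4[1+c]
... | refl = ladder-realises-4c+2 c m n≤m bound
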